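{- Let $\mathbf{L}$ be a complete residuated lattice, $F$ a type (set of function symbols with finite arities), $X$ a set of variables with $T_F(X)\neq\emptyset$, and let $\Sigma\colon T_F(X)\times T_F(X)\to L$ be an $\mathbf{L}$-set of inequalities. Then the semantic closure of $\Sigma$ is contained in the syntactic closure of $\Sigma$, i.e. $\Sigma^{\mathrm{sem}}(t,t')\le \Sigma^{\mathrm{syn}}(t,t')$ for all $t,t'\in T_F(X)$.
   Context: A complete residuated lattice is $\mathbf{L}=\langle L,\wedge,\vee,\otimes,\rightarrow,0,1\rangle$ where $\langle L,\wedge,\vee,0,1\rangle$ is a complete lattice, $\langle L,\otimes,1\rangle$ is a commutative monoid, and $a\otimes b\le c$ iff $a\le b\rightarrow c$. An $\mathbf{L}$-set in $M$ is a map $M\to L$; for $\mathbf{L}$-sets, $A_1\subseteq A_2$ means pointwise $\le$, and intersections are pointwise infima. An algebra with $\mathbf{L}$-order of type $F$ is $\mathbf{M}=\langle M,\preccurlyeq^{\mathbf{M}},F^{\mathbf{M}}\rangle$ where $\langle M,F^{\mathbf{M}}\rangle$ is an algebra of type $F$ and $\preccurlyeq^{\mathbf{M}}\colon M\times M\to L$ satisfies: (i) $a\preccurlyeq^{\mathbf{M}} b=b\preccurlyeq^{\mathbf{M}} a=1$ iff $a=b$; (ii) $(a\preccurlyeq^{\mathbf{M}} b)\otimes(b\preccurlyeq^{\mathbf{M}} c)\le a\preccurlyeq^{\mathbf{M}} c$; (iii) $(a_1\preccurlyeq^{\mathbf{M}} b_1)\otimes\cdots\otimes(a_n\preccurlyeq^{\mathbf{M}}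 b_n)\le f^{\mathbf{M}}(a_1,\dots,a_n)\preccurlyeq^{\mathbf{M}} f^{\mathbf{M}}(b_1,\dots,b_n)$ for every $n$-ary $f\in F$ and all elements. $T_F(X)$ is the set of terms over $F$ and $X$. Formulas (inequalities) $t\preccurlyeq t'$ are identified with pairs $\langle t,t'\rangle\in T_F(X)\times T_F(X)$. For a map $v\colon X\to M$, $\|t\|_{\mathbf{M},v}$ is the usual value of $t$ in $\mathbf{M}$ under $v$, and $\|t\preccurlyeq t'\|_{\mathbf{M},v}=\|t\|_{\mathbf{M},v}\preccurlyeq^{\mathbf{M}}\|t'\|_{\mathbf{M},v}$; $\|t\preccurlyeq t'\|_{\mathbf{M}}=\bigwedge_{v\colon X\to M}\|t\preccurlyeq t'\|_{\mathbf{M},v}$. $\mathbf{M}$ is a model of $\Sigma$ if $\Sigma(t,t')\le\|t\preccurlyeq t'\|_{\mathbf{M}}$ for all $t,t'$. The degree of semantic entailment is $\|t\preccurlyeq t'\|_{\Sigma}=\bigwedge\{\|t\preccurlyeq t'\|_{\mathbf{M}}:\mathbf{M}\text{ a model of }\Sigma\}$. $\Sigma'$ is semantically closed if $\|t\preccurlyeq t'\|_{\Sigma'}\le\Sigma'(t,t')$ for all $t,t'$; the semantic closure $\Sigma^{\mathrm{sem}}$ is the intersection of all semantically closed $\Sigma'$ with $\Sigma\subseteq\Sigma'$. $\Sigma'$ is syntactically closed if for all $t,t',t'',t_i,t_i'\in T_F(X)$, every $n$-ary $f\in F$, and every homomorphism $h$ of the term algebra (i.e. every substitution map $T_F(X)\to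 T_F(X)$ obtained by replacing each variable $x$ by a term $h(x)$): $\Sigma'(t,t)=1$; $\Sigma'(t,t')\otimes\Sigma'(t',t'')\le\Sigma'(t,t'')$; $\Sigma'(t_1,t_1')\otimes\cdots\otimes\Sigma'(t_n,t_n')\le\Sigma'(f(t_1,\dots,t_n),f(t_1',\dots,t_n'))$; $\Sigma'(t,t')\le\Sigma'(h(t),h(t'))$. The syntactic closure $\Sigma^{\mathrm{syn}}$ is the intersection of all syntactically closed $\Sigma'$ with $\Sigma\subseteq\Sigma'$. -}

module Defs where

open import Level using (Level; _⊔_; suc; Setω)
open import Data.Nat using (ℕ)
open import Data.Vec using (Vec; []; _∷_; foldr′; zipWith)
open import Data.Product using (Σ; _×_; _,_)
open import Function.Bundles using (_⇔_)
open import Relation.Binary.PropositionalEquality using (_≡_)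
open import Relation.Binary.Core using (Rel)
open import Relation.Binary.Structures using (IsPartialOrder; IsEquivalence)

record CompleteResiduatedLattice (ℓ : Level) : Setω where
  infixr 7 _⊗_
  infixr 6 _∧_
  infixr 6 _∨_
  infixr 5 _⇒_
  infix  4 _≤_
  field
    Carrier : Set ℓ
    _≤_     : Rel Carrier ℓ
    isPartialOrder : IsPartialOrder _≡_ _≤_
    _∧_ _∨_ _⊗_ _⇒_ : Carrier → Carrier → Carrier
    𝟘 𝟙     : Carrier
    ∧-lowerˡ : ∀ a b → a ∧ b ≤ a
    ∧-lowerʳ : ∀ a b → a ∧ b ≤ b
    ∧-greatest : ∀ {a b c} → c ≤ a → c ≤ b → c ≤ a ∧ b
    ∨-upperˡ : ∀ a b → a ≤ a ∨ b
    ∨-upperʳ : ∀ a b → b ≤ a ∨ b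
    ∨-least  : ∀ {a b c} → a ≤ c → b ≤ c → a ∨ b ≤ c
    𝟘-min : ∀ a → 𝟘 ≤ a
    𝟙-max : ∀ a → a ≤ 𝟙
    ⋀ : ∀ {ι} {I : Set ι} → (I → Carrier) → Carrier
    ⋀-lower : ∀ {ι} {I : Set ι} (g : I → Carrier) (i : I) → ⋀ g ≤ g i
    ⋀-greatest : ∀ {ι} {I : Set ι} (g : I → Carrier) {c : Carrier} →
                 (∀ i → c ≤ g i) → c ≤ ⋀ g
    ⊗-assoc : ∀ a b c → (a ⊗ b) ⊗ c ≡ a ⊗ (b ⊗ c)
    ⊗-comm  : ∀ a b → a ⊗ b ≡ b ⊗ a
    ⊗-identityˡ : ∀ a → 𝟙 ⊗ a ≡ a
    residuation : ∀ a b c → (a ⊗ b ≤ c) ⇔ (a ≤ b ⇒ c)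

  ⨂ : ∀ {n} → Vec Carrier n → Carrier
  ⨂ = foldr′ _⊗_ 𝟙

record Signature (f : Level) : Set (suc f) where
  field
    Sym   : Set f
    arity : Sym → ℕ
open Signature public

module Terms {f x : Level} (F : Signature f) (X : Set x) where

  data Term : Set (f ⊔ x) where
    var : X → Term
    app : (s : Sym F) → Vec Term (arity F s) → Term

  -- homomorphisms of the term algebra = substitutions
  mutual
    subst : (X → Term) → Term → Term
    subst h (var y)    = h y
    subst h (app s ts) = app s (subst* h ts)

    subst* : ∀ {n} → (X → Term) → Vec Term n → Vec Term n
    subst* h []       = []
    subst* h (t ∷ ts) = subst h t ∷ subst* h ts

module Semantics {ℓ f x : Level} (𝐋 : CompleteResiduatedLattice ℓ)
                 (F : Signature f) (X : Set x) where
  open CompleteResiduatedLattice 𝐋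
  open Terms F X

  L = Carrier

  LSet : Set (ℓ ⊔ f ⊔ x)
  LSet = Term → Term → L

  _⊆_ : LSet → LSet → Set (ℓ ⊔ f ⊔ x)
  Σ₁ ⊆ Σ₂ = ∀ t t' → Σ₁ t t' ≤ Σ₂ t t'

  -- Algebras with L-order of type F.  The carrier is a setoid (M, ≈);
  -- ≈ plays the role of equality "a = b" in condition (i).
  record LOrderedAlgebra (m e : Level) : Set (suc (m ⊔ e) ⊔ ℓ ⊔ f) where
    field
      M     : Set m
      _≈_   : Rel M e
      ≈-isEquivalence : IsEquivalence _≈_
      _≼_   : M → M → L
      op    : (s : Sym F) → Vec M (arity F s) → M
      ≼-antisym-refl : ∀ a b → ((a ≼ b ≡ 𝟙) × (b ≼ a ≡ 𝟙)) ⇔ (a ≈ b)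
      ≼-trans : ∀ a b c → (a ≼ b) ⊗ (b ≼ c) ≤ a ≼ c
      ≼-compat : ∀ (s : Sym F) (as bs : Vec M (arity F s)) →
                 ⨂ (zipWith _≼_ as bs) ≤ op s as ≼ op s bs

  module _ {m e : Level} (𝐌 : LOrderedAlgebra m e) where
    open LOrderedAlgebra 𝐌

    mutual
      ⟦_⟧ : Term → (X → M) → M
      ⟦ var y ⟧    v = v y
      ⟦ app s ts ⟧ v = op s (⟦ ts ⟧* v)

      ⟦_⟧* : ∀ {n} → Vec Term n → (X → M) → Vec M n
      ⟦ [] ⟧*     v = []
      ⟦ t ∷ ts ⟧* v = ⟦ t ⟧ v ∷ ⟦ ts ⟧* v

    ‖_≼_‖[_] : Term → Term → (X → M) → L
    ‖ t ≼ t' ‖[ v ] = ⟦ t ⟧ v ≼ ⟦ t' ⟧ v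

    ‖_≼_‖ : Term → Term → L
    ‖ t ≼ t' ‖ = ⋀ (λ (v : X → M) → ‖ t ≼ t' ‖[ v ])

    IsModel : LSet → Set (ℓ ⊔ f ⊔ x)
    IsModel Σ′ = ∀ t t' → Σ′ t t' ≤ ‖ t ≼ t' ‖

  open LOrderedAlgebra using (M)

  module SemClosure (m e : Level) where
    Model : Set _
    Model = LOrderedAlgebra (f ⊔ x ⊔ m) (ℓ ⊔ e)

    entail : LSet → Term → Term → L
    entail Σ′ t t' = ⋀ (λ (p : Σ Model (λ 𝐌 → IsModel 𝐌 Σ′)) →
                           let (𝐌 , _) = p in ‖_≼_‖ 𝐌 t t')

    SemClosed : LSet → Set (ℓ ⊔ f ⊔ x)
    SemClosed Σ′ = ∀ t t' → entail Σ′ t t' ≤ Σ′ t t'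

    sem : LSet → LSet
    sem Σ₀ t t' = ⋀ (λ (p : Σ LSet (λ Σ′ → SemClosed Σ′ × (Σ₀ ⊆ Σ′))) →
                       let (Σ′ , _) = p in Σ′ t t')

  record SynClosed (Σ′ : LSet) : Set (ℓ ⊔ f ⊔ x) where
    field
      refl′  : ∀ t → Σ′ t t ≡ 𝟙
      trans′ : ∀ t t' t'' → Σ′ t t' ⊗ Σ′ t' t'' ≤ Σ′ t t''
      compat′ : ∀ (s : Sym F) (ts ts' : Vec Term (arity F s)) →
                ⨂ (zipWith Σ′ ts ts') ≤ Σ′ (app s ts) (app s ts')
      subst′ : ∀ (h : X → Term) t t' → Σ′ t t' ≤ Σ′ (subst h t) (subst h t')

  syn : LSet → LSet
  syn Σ₀ t t' = ⋀ (λ (p : Σ LSet (λ Σ′ → SynClosed Σ′ × (Σ₀ ⊆ Σ′))) →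
                     let (Σ′ , _) = p in Σ′ t t')

-- Every syntactically closed Σ′ is semantically closed: its term algebra,
-- ordered by Σ′ itself, is a model of Σ′ (closure under substitution says
-- exactly that every valuation respects Σ′), and evaluating t ≼ t′ there
-- under the identity valuation x ↦ x gives back Σ′ t t′.  Hence every set
-- over which the syntactic closure takes its infimum also occurs in the
-- infimum defining the semantic closure.
module Submission where

open import Defs
open import Level using (Level; Lift; lift; lower; _⊔_)
open import Data.Vec using (Vec; []; _∷_; map; zipWith)
open import Data.Vec.Properties using (zipWith-map₁; zipWith-map₂)
open import Data.Product using (_×_; _,_)
open import Function using (_∘_)
open import Function.Bundles using (mk⇔)
open import Relation.Binary.PropositionalEquality
  using (_≡_; refl; sym; trans; cong; cong₂; subst₂)
  renaming (subst to ≡-subst)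
open import Relation.Binary.Structures using (IsPartialOrder; IsEquivalence)

module TermProperties {f x : Level} (F : Signature f) (X : Set x) where
  open Terms F X

  mutual
    subst-var : ∀ t → subst var t ≡ t
    subst-var (var y)    = refl
    subst-var (app s ts) = cong (app s) (subst*-var ts)

    subst*-var : ∀ {n} (ts : Vec Term n) → subst* var ts ≡ ts
    subst*-var []       = refl
    subst*-var (t ∷ ts) = cong₂ _∷_ (subst-var t) (subst*-var ts)

module LatticeProperties {ℓ : Level} (𝐋 : CompleteResiduatedLattice ℓ) where
  open CompleteResiduatedLattice 𝐋
  open IsPartialOrder isPartialOrder using (antisym) renaming (trans to ≤-trans)

  ≤-reflexive : ∀ {a b} → a ≡ b → a ≤ b
  ≤-reflexive = IsPartialOrder.reflexive isPartialOrder

  ⋀-mono-reindex : ∀ {ι κ} {I : Set ι} {J : Set κ} (g : I → Carrier) (h : J → Carrier) →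
                   (r : J → I) → (∀ j → g (r j) ≤ h j) → ⋀ g ≤ ⋀ h
  ⋀-mono-reindex g h r g∘r≤h = ⋀-greatest h λ j → ≤-trans (⋀-lower g (r j)) (g∘r≤h j)

  ⊗-𝟙-trans : ∀ {a b c} → a ⊗ b ≤ c → a ≡ 𝟙 → b ≡ 𝟙 → c ≡ 𝟙
  ⊗-𝟙-trans {c = c} ab≤c refl refl =
    antisym (𝟙-max c) (≤-trans (≤-reflexive (sym (⊗-identityˡ 𝟙))) ab≤c)

module _ {ℓ f x : Level} (𝐋 : CompleteResiduatedLattice ℓ) (F : Signature f) (X : Set x)
         (m e : Level) where
  open CompleteResiduatedLattice 𝐋
  open LatticeProperties 𝐋
  open IsPartialOrder isPartialOrder using () renaming (trans to ≤-trans)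
  open Terms F X
  open TermProperties F X
  open Semantics 𝐋 F X
  open SemClosure m e

  -- The term algebra is lifted to level m and its setoid equality to level e
  -- so that it lives in the universe over which semantic entailment quantifies.
  module TermModel (Σ′ : LSet) (closed : SynClosed Σ′) where
    open SynClosed closed

    Carrierᵀ : Set (f ⊔ x ⊔ m)
    Carrierᵀ = Lift m Term

    _≼ᵀ_ : Carrierᵀ → Carrierᵀ → L
    a ≼ᵀ b = Σ′ (lower a) (lower b)

    _≈ᵀ_ : Carrierᵀ → Carrierᵀ → Set (ℓ ⊔ e)
    a ≈ᵀ b = Lift e ((a ≼ᵀ b ≡ 𝟙) × (b ≼ᵀ a ≡ 𝟙))

    ≼ᵀ-𝟙-trans : ∀ a b c → a ≼ᵀ b ≡ 𝟙 → b ≼ᵀ c ≡ 𝟙 → a ≼ᵀ c ≡ 𝟙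
    ≼ᵀ-𝟙-trans a b c = ⊗-𝟙-trans (trans′ (lower a) (lower b) (lower c))

    ≈ᵀ-isEquivalence : IsEquivalence _≈ᵀ_
    ≈ᵀ-isEquivalence = record
      { refl  = λ {a} → lift (refl′ (lower a) , refl′ (lower a))
      ; sym   = λ { (lift (ab , ba)) → lift (ba , ab) }
      ; trans = λ {a} {b} {c} → λ { (lift (ab , ba)) (lift (bc , cb)) →
                  lift (≼ᵀ-𝟙-trans a b c ab bc , ≼ᵀ-𝟙-trans c b a cb ba) }
      }

    zipWith-≼ᵀ : ∀ {n} (as bs : Vec Carrierᵀ n) →
                 zipWith Σ′ (map lower as) (map lower bs) ≡ zipWith _≼ᵀ_ as bs
    zipWith-≼ᵀ as bs = trans (zipWith-map₁ Σ′ lower as (map lower bs))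
                             (zipWith-map₂ (λ a t → Σ′ (lower a) t) lower as bs)

    termModel : Model
    termModel = record
      { M               = Carrierᵀ
      ; _≈_             = _≈ᵀ_
      ; ≈-isEquivalence = ≈ᵀ-isEquivalence
      ; _≼_             = _≼ᵀ_
      ; op              = λ s as → lift (app s (map lower as))
      ; ≼-antisym-refl  = λ a b → mk⇔ lift lower
      ; ≼-trans         = λ a b c → trans′ (lower a) (lower b) (lower c)
      ; ≼-compat        = λ s as bs →
          ≡-subst (λ ρ → ⨂ ρ ≤ Σ′ (app s (map lower as)) (app s (map lower bs)))
                  (zipWith-≼ᵀ as bs) (compat′ s (map lower as) (map lower bs))
      }

    mutual
      ⟦⟧-subst : ∀ t (v : X → Carrierᵀ) → lower (⟦_⟧ termModel t v) ≡ subst (lower ∘ v) t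
      ⟦⟧-subst (var y)    v = refl
      ⟦⟧-subst (app s ts) v = cong (app s) (⟦⟧*-subst ts v)

      ⟦⟧*-subst : ∀ {n} (ts : Vec Term n) (v : X → Carrierᵀ) →
                  map lower (⟦_⟧* termModel ts v) ≡ subst* (lower ∘ v) ts
      ⟦⟧*-subst []       v = refl
      ⟦⟧*-subst (t ∷ ts) v = cong₂ _∷_ (⟦⟧-subst t v) (⟦⟧*-subst ts v)

    ⟦⟧-var : ∀ t → lower (⟦_⟧ termModel t (lift ∘ var)) ≡ t
    ⟦⟧-var t = trans (⟦⟧-subst t (lift ∘ var)) (subst-var t)

    termModel-isModel : IsModel termModel Σ′
    termModel-isModel t t' = ⋀-greatest _ λ v →
      subst₂ (λ u u' → Σ′ t t' ≤ Σ′ u u')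
             (sym (⟦⟧-subst t v)) (sym (⟦⟧-subst t' v)) (subst′ (lower ∘ v) t t')

    ‖≼‖-termModel : ∀ t t' → ‖_≼_‖ termModel t t' ≤ Σ′ t t'
    ‖≼‖-termModel t t' =
      subst₂ (λ u u' → ‖_≼_‖ termModel t t' ≤ Σ′ u u') (⟦⟧-var t) (⟦⟧-var t')
             (⋀-lower _ (lift ∘ var))

  synClosed⇒semClosed : ∀ {Σ′} → SynClosed Σ′ → SemClosed Σ′
  synClosed⇒semClosed {Σ′} closed t t' =
    ≤-trans (⋀-lower _ (termModel , termModel-isModel)) (‖≼‖-termModel t t')
    where open TermModel Σ′ closed

  sem⊆syn : ∀ Σ₀ → sem Σ₀ ⊆ syn Σ₀
  sem⊆syn Σ₀ t t' =
    ⋀-mono-reindex _ _ (λ { (Σ′ , closed , Σ₀⊆Σ′) → Σ′ , synClosed⇒semClosed closed , Σ₀⊆Σ′ })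
                   (λ _ → ≤-reflexive refl)

lemma2 : ∀ {ℓ f x : Level} (𝐋 : CompleteResiduatedLattice ℓ) (F : Signature f) (X : Set x)
    → Terms.Term F X
    → (Σ₀ : Semantics.LSet 𝐋 F X)
    → (m e : Level)
    → ∀ t t' → CompleteResiduatedLattice._≤_ 𝐋 (Semantics.SemClosure.sem 𝐋 F X m e Σ₀ t t') (Semantics.syn 𝐋 F X Σ₀ t t')
lemma2 𝐋 F X _ Σ₀ m e = sem⊆syn 𝐋 F X m e Σ₀
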